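{- For every system of CFSMs $S=(M_X)_{X\in P}$, $\mathbf{L}(\mathit{cs}(S))=[\![\hat S]\!]$, where $\hat S=(\mathbf{L}(M_X))_{X\in P}$.
   Context: Fix disjoint sets $\mathfrak{P}$ (participants) and $\mathfrak{M}$ (messages); interactions $\Sigma_{int}=\{A\to B{:}m\mid A\neq B\in\mathfrak{P},m\in\mathfrak{M}\}$, actions $\Sigma_{act}=\{AB!m,AB?m\}$ (subject of $AB!m$ is $A$, of $AB?m$ is $B$). A finite state automaton (FSA) is $\langle\mathcal{S},q_0,\mathcal{L},\to\rangle$ with finite state set, initial state $q_0$, finite label set and transitions $\to\subseteq\mathcal{S}\times\mathcal{L}\times\mathcal{S}$; all states are accepting, and its language $\mathbf{L}(A)$ is the set of finite words labelling finite paths from $q_0$ together with infinite words labelling infinite paths from $q_0$. A CFSM is a deterministic FSA (no $\varepsilon$-labels, and from each state at most one transition per label) labelled in $\Sigma_{act}$; it is $A$-local if all transitions have subject $A$. A system of CFSMs over a finite $P\subseteq\mathfrak{P}$ is a family $(M_A)_{A\in P}$ with $M_A=\langle\mathcal{S}_A,q_{0A},\Sigma_{act},\to_A\rangle$ $A$-local and mentioning only participants in $P$. Its synchronous semantics $\mathit{cs}(S)$ is the FSA whose states are configurations $s=(q_A)_{A\in P}$ with $q_A\in\mathcal{S}_A$, initial configuration $s_0(A)=q_{0A}$, labels $\Sigma_{int}$, and a transition $s_1\xrightarrow{A\to B:m}s_2$ iff $s_1(A)\xrightarrow{AB!m}s_2(A)$ in $M_A$, $s_1(B)\xrightarrow{AB?m}s_2(B)$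 in $M_B$, and $s_1(X)=s_2(X)$ for all $X\in P\setminus\{A,B\}$. Projection of interaction words: $(A\to B{:}m){\upharpoonright}_A=AB!m$, $(A\to B{:}m){\upharpoonright}_B=AB?m$, $\varepsilon$ for other participants, extended homomorphically. For a family $\hat S$ of action languages indexed by $P$, $[\![\hat S]\!]=\{w\in\Sigma_{int}^\infty\mid$ all participants of $w$ are in $P$ and $w{\upharpoonright}_X\in\hat S(X)$ for all $X\in P\}$. -}

module Defs where

open import Data.Nat using (ℕ; zero; suc; _≤_; _<_)
open import Data.List using (List; []; _∷_; _++_; mapMaybe)
open import Data.List.Membership.Propositional using (_∈_)
open import Data.List.Relation.Unary.All using (All)
open import Data.Maybe using (Maybe; just; nothing)
open import Data.Product using (Σ; ∃; _×_; _,_; ∃-syntax)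
open import Data.Fin using (Fin)
open import Relation.Binary.PropositionalEquality using (_≡_; _≢_)
open import Relation.Binary.Definitions using (DecidableEquality)
open import Relation.Nullary using (¬_; yes; no)

data Word (L : Set) : Set where
  fin : List L → Word L
  inf : (ℕ → L) → Word L

Language : Set → Set₁
Language L = Word L → Set

_≐_ : ∀ {L : Set} → Language L → Language L → Set
K ≐ K′ = ∀ w → (K w → K′ w) × (K′ w → K w)

prefix : ∀ {L : Set} → (ℕ → L) → ℕ → List L
prefix f zero = []
prefix f (suc n) = f zero ∷ prefix (λ k → f (suc k)) n

record LTS (L : Set) : Set₁ where
  field
    State : Set
    init  : State
    step  : State → L → State → Set

open LTS public

data Run {L : Set} (T : LTS L) : State T → List L → State T → Set where
  []  : ∀ {q} → Run T q [] q
  _∷_ : ∀ {q a q′ l q″} → step T q a q′ → Run T q′ l q″ → Run T q (a ∷ l) q″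

𝐋 : ∀ {L : Set} → LTS L → Language L
𝐋 T (fin l) = ∃[ q ] Run T (init T) l q
𝐋 T (inf f) = Σ (ℕ → State T) λ σ →
  (σ zero ≡ init T) × (∀ n → step T (σ n) (f n) (σ (suc n)))

record FSA (L : Set) : Set where
  field
    nStates : ℕ
    q₀      : Fin nStates
    trans   : List (Fin nStates × L × Fin nStates)

open FSA public

FStep : ∀ {L : Set} (M : FSA L) → Fin (nStates M) → L → Fin (nStates M) → Set
FStep M q a q′ = (q , a , q′) ∈ trans M

toLTS : ∀ {L : Set} → FSA L → LTS L
toLTS M = record { State = Fin (nStates M) ; init = q₀ M ; step = FStep M }

Deterministic : ∀ {L : Set} → FSA L → Set
Deterministic M = ∀ {q a q₁ q₂} → FStep M q a q₁ → FStep M q a q₂ → q₁ ≡ q₂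

module _ {Part Msg : Set} where

  data Int : Set where
    _⟶_∶_⟨_⟩ : (A B : Part) → Msg → .(A ≢ B) → Int

  data Act : Set where
    send : (A B : Part) → Msg → .(A ≢ B) → Act
    recv : (A B : Part) → Msg → .(A ≢ B) → Act

  subject : Act → Part
  subject (send A B m _) = A
  subject (recv A B m _) = B

  ActIn : List Part → Act → Set
  ActIn P (send A B m _) = A ∈ P × B ∈ P
  ActIn P (recv A B m _) = A ∈ P × B ∈ P

  IntIn : List Part → Int → Set
  IntIn P (A ⟶ B ∶ m ⟨ _ ⟩) = A ∈ P × B ∈ P

  WordIn : List Part → Word Int → Set
  WordIn P (fin l) = All (IntIn P) l
  WordIn P (inf w) = ∀ n → IntIn P (w n)

  Local : Part → FSA Act → Set
  Local A M = ∀ {q a q′} → FStep M q a q′ → subject a ≡ A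

  MentionsOnly : List Part → FSA Act → Set
  MentionsOnly P M = ∀ {q a q′} → FStep M q a q′ → ActIn P a

  IsSystem : List Part → (Part → FSA Act) → Set
  IsSystem P M = ∀ {A} → A ∈ P →
    Deterministic (M A) × Local A (M A) × MentionsOnly P (M A)

  -- synchronous semantics cs(S).  Configurations assign a state to every
  -- participant; components outside P are never changed, so they stay
  -- at their initial state.
  cs : List Part → (Part → FSA Act) → LTS Int
  cs P M = record
    { State = (X : Part) → Fin (nStates (M X))
    ; init  = λ X → q₀ (M X)
    ; step  = λ { s₁ (A ⟶ B ∶ m ⟨ d ⟩) s₂ →
                   A ∈ P × B ∈ P
                 × FStep (M A) (s₁ A) (send A B m d) (s₂ A)
                 × FStep (M B) (s₁ B) (recv A B m d) (s₂ B)
                 × (∀ X → X ≢ A → X ≢ B → s₁ X ≡ s₂ X) }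
    }

module _ {Part Msg : Set} (_≟_ : DecidableEquality Part) where

  projI : Part → Int {Part} {Msg} → Maybe Act
  projI X (A ⟶ B ∶ m ⟨ d ⟩) with X ≟ A | X ≟ B
  ... | yes _ | _     = just (send A B m d)
  ... | no _  | yes _ = just (recv A B m d)
  ... | no _  | no _  = nothing

  projL : Part → List (Int {Part} {Msg}) → List Act
  projL X = mapMaybe (projI X)

  -- Proj X w u :  u = w↾X   (graph of the projection on Σ_int^∞)
  Proj : Part → Word (Int {Part} {Msg}) → Word Act → Set
  Proj X (fin l) u = u ≡ fin (projL X l)
  Proj X (inf w) (fin l) = Σ ℕ λ n →
      (∀ m → n ≤ m → projI X (w m) ≡ nothing)
    × projL X (prefix w n) ≡ l
  Proj X (inf w) (inf v) = Σ (ℕ → ℕ) λ f →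
      (∀ k → f k < f (suc k))
    × (∀ m → projI X (w m) ≢ nothing → ∃[ k ] f k ≡ m)
    × (∀ k → projI X (w (f k)) ≡ just (v k))

  ⟦_∣_⟧ : List Part → (Part → Language (Act {Part} {Msg})) → Language (Int {Part} {Msg})
  ⟦ P ∣ Ŝ ⟧ w = WordIn P w × (∀ X → X ∈ P → ∃[ u ] Proj X w u × Ŝ X u)

-- Configurations of cs(S) are tuples of local states, and a synchronous step A → B : m is exactly a
-- simultaneous step of every machine on its own projection of the interaction, where an empty
-- projection means staying put.  So cs(S) is the synchronous product of the automata M X read through
-- the projections ↾X, and a word is accepted by a product iff it is accepted componentwise.  For an
-- infinite word w the projection w↾X is finite exactly when w is eventually silent for X; otherwise
-- the positions visible to X are enumerated by a strictly increasing f, and paths of M X along w↾X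
-- correspond to paths along w that only move at those positions.  Telling the two cases apart, and
-- finding the next visible position in the second, is where excluded middle is needed.

module Submission where

open import Defs hiding (trans)
open import Level using (0ℓ)
open import Axiom.ExcludedMiddle using (ExcludedMiddle)
open import Axiom.DoubleNegationElimination using (em⇒dne)
open import Data.Empty.Irrelevant renaming (⊥-elim to ⊥-elim-irr)
open import Data.List using (List; []; _∷_; mapMaybe)
open import Data.List.Membership.Propositional using (_∈_)
open import Data.List.Relation.Unary.All using (All; []; _∷_)
open import Data.Maybe using (Maybe; just; nothing)
open import Data.Maybe.Properties using (just-injective)
open import Data.Nat using (ℕ; zero; suc; _+_; _∸_; _≤_; _<_; _<?_; z≤n; s≤s; s≤s⁻¹)
open import Data.Nat.Properties
open import Data.Product using (Σ; ∃; ∃-syntax; _×_; _,_; proj₁; proj₂)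
open import Data.Sum using (_⊎_; inj₁; inj₂; [_,_])
open import Function using (_∘_; id)
open import Function.Bundles using (_⇔_; mk⇔; Equivalence)
open import Function.Construct.Composition using (_⇔-∘_)
open import Relation.Binary.Definitions using (DecidableEquality; tri<; tri≈; tri>)
open import Relation.Binary.PropositionalEquality
  using (_≡_; _≢_; refl; sym; trans; cong; subst; module ≡-Reasoning)
open import Relation.Nullary using (¬_; Dec; yes; no; contradiction)
open import Relation.Nullary.Decidable using (¬?; decidable-stable)
open import Relation.Unary using (Decidable)

IsPath : ∀ {L} (T : LTS L) → (ℕ → State T) → (ℕ → L) → Set
IsPath T σ f = ∀ n → step T (σ n) (f n) (σ (suc n))

path⇒prefix-run : ∀ {L} {T : LTS L} {σ f} → IsPath T σ f →
  ∀ n → Run T (σ 0) (prefix f n) (σ n)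
path⇒prefix-run path zero    = []
path⇒prefix-run path (suc n) = path 0 ∷ path⇒prefix-run (path ∘ suc) n

prefix-run⇒path : ∀ {L} {T : LTS L} {q q′} f n → Run T q (prefix f n) q′ →
  (∀ m → n ≤ m → step T q′ (f m) q′) →
  Σ (ℕ → State T) λ σ → σ 0 ≡ q × IsPath T σ f
prefix-run⇒path {q = q} f zero [] stutter = (λ _ → q) , refl , λ m → stutter m z≤n
prefix-run⇒path {T = T} {q} f (suc n) (s ∷ r) stutter
  with prefix-run⇒path (λ k → f (suc k)) n r (λ m n≤m → stutter (suc m) (s≤s n≤m))
... | σ , σ₀ , path = σ′ , refl , path′
  where
  σ′ : ℕ → State T
  σ′ zero    = q
  σ′ (suc k) = σ k

  path′ : IsPath T σ′ f
  path′ zero    = subst (step T q (f 0)) (sym σ₀) s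
  path′ (suc k) = path k

𝐋-simulation : ∀ {L} {T U : LTS L} (h : State T → State U) → h (init T) ≡ init U →
  (∀ {q a q′} → step T q a q′ → step U (h q) a (h q′)) → ∀ w → 𝐋 T w → 𝐋 U w
𝐋-simulation {T = T} {U} h h₀ simulate (fin l) (q , r) =
  h q , subst (λ p → Run U p l (h q)) h₀ (map-run r)
  where
  map-run : ∀ {p l p′} → Run T p l p′ → Run U (h p) l (h p′)
  map-run []      = []
  map-run (s ∷ r) = simulate s ∷ map-run r
𝐋-simulation h h₀ simulate (inf f) (σ , σ₀ , path) =
  h ∘ σ , trans (cong h σ₀) h₀ , simulate ∘ path

≟-nothing : ∀ {A : Set} (x : Maybe A) → Dec (x ≡ nothing)
≟-nothing nothing  = yes refl
≟-nothing (just _) = no λ ()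

≢nothing⇒just : ∀ {A : Set} {x : Maybe A} → x ≢ nothing → ∃[ a ] x ≡ just a
≢nothing⇒just {x = nothing} x≢nothing = contradiction refl x≢nothing
≢nothing⇒just {x = just a}  _         = a , refl

just⇒≢nothing : ∀ {A : Set} {x : Maybe A} {a} → x ≡ just a → x ≢ nothing
just⇒≢nothing refl ()

record MinimalAbove (Q : ℕ → Set) (n : ℕ) : Set where
  constructor minimal
  field
    value       : ℕ
    above       : n ≤ value
    holds       : Q value
    below-fails : ∀ k → n ≤ k → k < value → ¬ Q k

minimalAbove : ∀ {Q : ℕ → Set} → Decidable Q → ∀ {n m} → n ≤ m → Q m → MinimalAbove Q n
minimalAbove {Q} Q? {n} {m} n≤m qm = search (m ∸ n) n (subst Q (sym (m∸n+n≡m n≤m)) qm)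
  where
  search : ∀ d n → Q (d + n) → MinimalAbove Q n
  search d n q with Q? n
  ... | yes qn = minimal n ≤-refl qn λ k n≤k k<n → contradiction n≤k (<⇒≱ k<n)
  search zero    n q | no ¬qn = contradiction q ¬qn
  search (suc d) n q | no ¬qn with search d (suc n) (subst Q (sym (+-suc d n)) q)
  ... | minimal m n<m qm below = minimal m (<⇒≤ n<m) qm below′
    where
    below′ : ∀ k → n ≤ k → k < m → ¬ Q k
    below′ k n≤k k<m with m≤n⇒m<n∨m≡n n≤k
    ... | inj₁ n<k  = below k n<k k<m
    ... | inj₂ refl = ¬qn

module StrictlyIncreasing {f : ℕ → ℕ} (f-inc : ∀ k → f k < f (suc k)) where

  inc-< : ∀ {j k} → j < k → f j < f k
  inc-< {j} {suc k} (s≤s j≤k) with m≤n⇒m<n∨m≡n j≤k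
  ... | inj₁ j<k  = <-trans (inc-< j<k) (f-inc k)
  ... | inj₂ refl = f-inc j

  inc-≤ : ∀ {j k} → j ≤ k → f j ≤ f k
  inc-≤ j≤k with m≤n⇒m<n∨m≡n j≤k
  ... | inj₁ j<k  = <⇒≤ (inc-< j<k)
  ... | inj₂ refl = ≤-refl

  inc-reflects-< : ∀ {j k} → f j < f k → j < k
  inc-reflects-< {j} {k} fj<fk with j <? k
  ... | yes j<k = j<k
  ... | no  j≮k = contradiction (inc-≤ (≮⇒≥ j≮k)) (<⇒≱ fj<fk)

  inc-≥-id : ∀ k → k ≤ f k
  inc-≥-id zero    = z≤n
  inc-≥-id (suc k) = ≤-<-trans (inc-≥-id k) (f-inc k)

StepMaybe : ∀ {A} (T : LTS A) → State T → Maybe A → State T → Set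
StepMaybe T q nothing  q′ = q ≡ q′
StepMaybe T q (just a) q′ = step T q a q′

stay-silent : ∀ {A} {T : LTS A} {q o} → o ≡ nothing → StepMaybe T q o q
stay-silent refl = refl

stepMaybe-nothing : ∀ {A} {T : LTS A} {q o q′} → o ≡ nothing → StepMaybe T q o q′ → q ≡ q′
stepMaybe-nothing refl q≡q′ = q≡q′

stepMaybe-just : ∀ {A} {T : LTS A} {q o a q′} → o ≡ just a → StepMaybe T q o q′ → step T q a q′
stepMaybe-just refl s = s

inverseImage : ∀ {I A : Set} → (I → Maybe A) → LTS A → LTS I
inverseImage g T = record
  { State = State T ; init = init T ; step = λ q i q′ → StepMaybe T q (g i) q′ }

module _ {I A : Set} (g : I → Maybe A) {T : LTS A} where

  run-inverseImage⁺ : ∀ {q l q′} → Run (inverseImage g T) q l q′ → Run T q (mapMaybe g l) q′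
  run-inverseImage⁺ [] = []
  run-inverseImage⁺ (_∷_ {a = a} s r) with g a
  ... | nothing = subst (λ q → Run T q _ _) (sym s) (run-inverseImage⁺ r)
  ... | just b  = s ∷ run-inverseImage⁺ r

  run-inverseImage⁻ : ∀ {q q′} l → Run T q (mapMaybe g l) q′ → Run (inverseImage g T) q l q′
  run-inverseImage⁻ []      [] = []
  run-inverseImage⁻ {q} (a ∷ l) r with g a in ga
  ... | nothing = stay-silent ga ∷ run-inverseImage⁻ l r
  ... | just b with r
  ...   | s ∷ r′ = subst (λ o → StepMaybe T q o _) (sym ga) s ∷ run-inverseImage⁻ l r′

module Visibility {A : Set} (o : ℕ → Maybe A) where

  Silent : ℕ → ℕ → Set
  Silent a b = ∀ k → a ≤ k → k < b → o k ≡ nothing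

  SilentFrom : ℕ → Set
  SilentFrom n = ∀ m → n ≤ m → o m ≡ nothing

  constant-on-silent : ∀ {S : Set} (x : ℕ → S) → (∀ n → o n ≡ nothing → x n ≡ x (suc n)) →
    ∀ {a b} → a ≤ b → Silent a b → x a ≡ x b
  constant-on-silent x stays {b = zero}  z≤n _ = refl
  constant-on-silent x stays {a} {suc b} a≤b+1 silent with m≤n⇒m<n∨m≡n a≤b+1
  ... | inj₂ refl       = refl
  ... | inj₁ (s≤s a≤b) =
    trans (constant-on-silent x stays a≤b silent′) (stays b (silent b a≤b ≤-refl))
    where
    silent′ : Silent a b
    silent′ k a≤k k<b = silent k a≤k (m≤n⇒m≤1+n k<b)

  Covers : (ℕ → ℕ) → Set
  Covers f = ∀ m → o m ≢ nothing → ∃[ k ] f k ≡ m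

  Enumerates : (ℕ → ℕ) → (ℕ → A) → Set
  Enumerates f v = (∀ k → f k < f (suc k)) × Covers f × (∀ k → o (f k) ≡ just (v k))

  gapStart : (ℕ → ℕ) → ℕ → ℕ
  gapStart f zero    = 0
  gapStart f (suc k) = suc (f k)

  Gapless : (ℕ → ℕ) → Set
  Gapless f = ∀ k → Silent (gapStart f k) (f k)

  module _ {f : ℕ → ℕ} (f-inc : ∀ k → f k < f (suc k)) where
    open StrictlyIncreasing f-inc

    no-value-in-gap : ∀ k {m} → gapStart f k ≤ m → m < f k → ¬ (∃[ j ] f j ≡ m)
    no-value-in-gap zero    _     fj<f0   (j , refl) with () ← inc-reflects-< fj<f0
    no-value-in-gap (suc k) fk<fj fj<fk+1 (j , refl) =
      <⇒≱ (inc-reflects-< fk<fj) (s≤s⁻¹ (inc-reflects-< fj<fk+1))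

    covers⇒gapless : Covers f → Gapless f
    covers⇒gapless covers k m start≤m m<fk = decidable-stable (≟-nothing (o m))
      λ visible → no-value-in-gap k start≤m m<fk (covers m visible)

    gapless⇒covers : Gapless f → Covers f
    gapless⇒covers gapless m visible =
      [ id , (λ fm<m → contradiction (inc-≥-id m) (<⇒≱ fm<m)) ] (reach m)
      where
      step-past : ∀ k → gapStart f k ≤ m → (∃[ j ] f j ≡ m) ⊎ f k < m
      step-past k start≤m with <-cmp (f k) m
      ... | tri< fk<m _ _ = inj₂ fk<m
      ... | tri≈ _ fk≡m _ = inj₁ (k , fk≡m)
      ... | tri> _ _ m<fk = contradiction (gapless k m start≤m m<fk) visible

      reach : ∀ k → (∃[ j ] f j ≡ m) ⊎ f k < m
      reach zero    = step-past zero z≤n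
      reach (suc k) = [ inj₁ , step-past (suc k) ] (reach k)

  Trace : (T : LTS A) → (ℕ → State T) → Set
  Trace T σ = ∀ n → StepMaybe T (σ n) (o n) (σ (suc n))

  trace-stays : ∀ {T : LTS A} {σ} → Trace T σ → ∀ n → o n ≡ nothing → σ n ≡ σ (suc n)
  trace-stays tr n on = stepMaybe-nothing on (tr n)

  visibleBefore : ℕ → ℕ
  visibleBefore zero    = 0
  visibleBefore (suc n) with o n
  ... | nothing = visibleBefore n
  ... | just _  = suc (visibleBefore n)

  visibleBefore-silent : ∀ n → o n ≡ nothing → visibleBefore n ≡ visibleBefore (suc n)
  visibleBefore-silent n on rewrite on = refl

  visibleBefore-visible : ∀ {n a} → o n ≡ just a → visibleBefore (suc n) ≡ suc (visibleBefore n)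
  visibleBefore-visible on rewrite on = refl

  module Enumeration {f : ℕ → ℕ} {v : ℕ → A} (f-inc : ∀ k → f k < f (suc k))
                     (gapless : Gapless f) (visible : ∀ k → o (f k) ≡ just (v k)) where

    gapStart≤ : ∀ k → gapStart f k ≤ f k
    gapStart≤ zero    = z≤n
    gapStart≤ (suc k) = f-inc k

    constant-on-gap : ∀ {S : Set} (x : ℕ → S) → (∀ n → o n ≡ nothing → x n ≡ x (suc n)) →
      ∀ k → x (gapStart f k) ≡ x (f k)
    constant-on-gap x stays k = constant-on-silent x stays (gapStart≤ k) (gapless k)

    visibleBefore-enum : ∀ k → visibleBefore (f k) ≡ k
    visibleBefore-enum zero    = sym (constant-on-gap visibleBefore visibleBefore-silent zero)
    visibleBefore-enum (suc k) = begin
      visibleBefore (f (suc k))    ≡⟨ constant-on-gap visibleBefore visibleBefore-silent (suc k) ⟨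
      visibleBefore (suc (f k))    ≡⟨ visibleBefore-visible (visible k) ⟩
      suc (visibleBefore (f k))    ≡⟨ cong suc (visibleBefore-enum k) ⟩
      suc k                ∎
      where open ≡-Reasoning

    trace⇒path : ∀ {T : LTS A} {σ} → Trace T σ → σ (f 0) ≡ σ 0 × IsPath T (σ ∘ f) v
    trace⇒path {T} {σ} tr = sym (constant-on-gap σ (trace-stays tr) zero) , path
      where
      path : IsPath T (σ ∘ f) v
      path k = subst (step T (σ (f k)) (v k)) (constant-on-gap σ (trace-stays tr) (suc k))
                 (stepMaybe-just (visible k) (tr (f k)))

    path⇒trace : ∀ {T : LTS A} {τ} → Covers f → IsPath T τ v → Trace T (τ ∘ visibleBefore)
    path⇒trace {T} {τ} covers path n with o n in on
    ... | nothing = refl  -- the with has already reduced visibleBefore (suc n) to visibleBefore n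
    ... | just a with covers n (just⇒≢nothing on)
    ...   | j , refl rewrite visibleBefore-enum j =
      subst (λ b → step T (τ j) b (τ (suc j))) (just-injective (trans (sym (visible j)) on)) (path j)

  InfinitelyVisible : Set
  InfinitelyVisible = ∀ n → ∃[ m ] n ≤ m × o m ≢ nothing

  not-eventually-silent : ExcludedMiddle 0ℓ → ¬ (∃ SilentFrom) → InfinitelyVisible
  not-eventually-silent em ¬silent n = em⇒dne em λ ¬visible →
    ¬silent (n , λ m n≤m →
      decidable-stable (≟-nothing (o m)) λ visible → ¬visible (m , n≤m , visible))

  module _ (infinitely : InfinitelyVisible) where
    open MinimalAbove

    firstVisible : ∀ n → MinimalAbove (λ m → o m ≢ nothing) n
    firstVisible n with infinitely n
    ... | m , n≤m , visible = minimalAbove (λ m → ¬? (≟-nothing (o m))) n≤m visible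

    silent-before-firstVisible : ∀ n → Silent n (value (firstVisible n))
    silent-before-firstVisible n m n≤m m<first =
      decidable-stable (≟-nothing (o m)) (below-fails (firstVisible n) m n≤m m<first)

    enum : ℕ → ℕ
    enum zero    = value (firstVisible 0)
    enum (suc k) = value (firstVisible (suc (enum k)))

    enum-inc : ∀ k → enum k < enum (suc k)
    enum-inc k = above (firstVisible (suc (enum k)))

    enum-gapless : Gapless enum
    enum-gapless zero    = silent-before-firstVisible 0
    enum-gapless (suc k) = silent-before-firstVisible (suc (enum k))

    enum-visible : ∀ k → o (enum k) ≢ nothing
    enum-visible zero    = holds (firstVisible 0)
    enum-visible (suc k) = holds (firstVisible (suc (enum k)))

    enumeration : Σ (ℕ → ℕ) λ f → Σ (ℕ → A) λ v → Enumerates f v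
    enumeration =
      enum , proj₁ ∘ label , enum-inc , gapless⇒covers enum-inc enum-gapless , proj₂ ∘ label
      where
      label : ∀ k → ∃[ a ] o (enum k) ≡ just a
      label k = ≢nothing⇒just (enum-visible k)

open Visibility using (SilentFrom; Enumerates)

IsImage : ∀ {I A : Set} → (I → Maybe A) → Word I → Word A → Set
IsImage g (fin l) u       = u ≡ fin (mapMaybe g l)
IsImage g (inf w) (fin l) = Σ ℕ λ n → SilentFrom (g ∘ w) n × mapMaybe g (prefix w n) ≡ l
IsImage g (inf w) (inf v) = Σ (ℕ → ℕ) λ f → Enumerates (g ∘ w) f v

Every : ∀ {L : Set} → (L → Set) → Word L → Set
Every Ok (fin l) = All Ok l
Every Ok (inf f) = ∀ n → Ok (f n)

module _ {I A : Set} (g : I → Maybe A) {T : LTS A} where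

  image⇒𝐋-inverseImage : ∀ w u → IsImage g w u → 𝐋 T u → 𝐋 (inverseImage g T) w
  image⇒𝐋-inverseImage (fin l) _ refl (q , r) = q , run-inverseImage⁻ g l r
  image⇒𝐋-inverseImage (inf w) (fin l) (n , silent , refl) (q , r) =
    prefix-run⇒path w n (run-inverseImage⁻ g (prefix w n) r) stays
    where
    stays : ∀ m → n ≤ m → StepMaybe T q (g (w m)) q
    stays m n≤m = stay-silent (silent m n≤m)
  image⇒𝐋-inverseImage (inf w) (inf v) (f , f-inc , covers , visible) (τ , τ₀ , path) =
    τ ∘ visibleBefore , τ₀ , path⇒trace covers path
    where
    open Visibility (g ∘ w)
    open Enumeration f-inc (covers⇒gapless f-inc covers) visible

  𝐋-inverseImage⇒image : ExcludedMiddle 0ℓ →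
    ∀ w → 𝐋 (inverseImage g T) w → ∃[ u ] IsImage g w u × 𝐋 T u
  𝐋-inverseImage⇒image em (fin l) (q , r) = fin (mapMaybe g l) , refl , q , run-inverseImage⁺ g r
  𝐋-inverseImage⇒image em (inf w) (σ , σ₀ , trace) with em {∃ (SilentFrom (g ∘ w))}
  ... | yes (n , silent) = fin _ , (n , silent , refl) , σ n ,
          subst (λ q → Run T q _ (σ n)) σ₀ (run-inverseImage⁺ g (path⇒prefix-run trace n))
  ... | no ¬silent
        with Visibility.enumeration (g ∘ w) (Visibility.not-eventually-silent (g ∘ w) em ¬silent)
  ...   | f , v , enumerates@(f-inc , covers , visible) =
          let σf₀≡σ₀ , path = trace⇒path trace in
          inf v , (f , enumerates) , σ ∘ f , trans σf₀≡σ₀ σ₀ , path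
    where
    open Visibility (g ∘ w)
    open Enumeration f-inc (covers⇒gapless f-inc covers) visible

  𝐋-inverseImage-silent : ∀ {Ok : I → Set} → (∀ {i} → Ok i → g i ≡ nothing) →
    ∀ w → Every Ok w → 𝐋 (inverseImage g T) w
  𝐋-inverseImage-silent {Ok} silent (fin l) ok = init T , stay ok
    where
    stay : ∀ {l} → All Ok l → Run (inverseImage g T) (init T) l (init T)
    stay []         = []
    stay (oki ∷ ok) = stay-silent (silent oki) ∷ stay ok
  𝐋-inverseImage-silent silent (inf f) ok =
    (λ _ → init T) , refl , λ n → stay-silent (silent (ok n))

sync : ∀ {J L : Set} → (L → Set) → (J → LTS L) → LTS L
sync {J} Ok T = record
  { State = (j : J) → State (T j)
  ; init  = λ j → init (T j)
  ; step  = λ s a s′ → Ok a × (∀ j → step (T j) (s j) a (s′ j))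
  }

module _ {J L : Set} {Ok : L → Set} {T : J → LTS L} where

  run-sync⁺ : ∀ {s l s′} → Run (sync Ok T) s l s′ → All Ok l × (∀ j → Run (T j) (s j) l (s′ j))
  run-sync⁺ []                = [] , λ _ → []
  run-sync⁺ ((ok , steps) ∷ r) = let oks , runs = run-sync⁺ r in ok ∷ oks , λ j → steps j ∷ runs j

  run-sync⁻ : ∀ {s l} → All Ok l → (∀ j → ∃[ q ] Run (T j) (s j) l q) → ∃[ s′ ] Run (sync Ok T) s l s′
  run-sync⁻ {s} []         runs = s , []
  run-sync⁻ {s} {a ∷ l} (ok ∷ oks) runs =
    let s′ , r = run-sync⁻ oks (proj₂ ∘ proj₂ ∘ split) in s′ , (ok , proj₁ ∘ proj₂ ∘ split) ∷ r
    where
    split : ∀ j → Σ (State (T j)) λ q → step (T j) (s j) a q × ∃[ q′ ] Run (T j) q l q′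
    split j with runs j
    ... | q′ , st ∷ r = _ , st , q′ , r

  𝐋-sync : ∀ w → 𝐋 (sync Ok T) w ⇔ (Every Ok w × ∀ j → 𝐋 (T j) w)
  𝐋-sync (fin l) = mk⇔
    (λ (s′ , r) → let oks , runs = run-sync⁺ r in oks , λ j → s′ j , runs j)
    (λ (oks , runs) → run-sync⁻ oks runs)
  𝐋-sync (inf f) = mk⇔
    (λ (σ , σ₀ , path) →
      proj₁ ∘ path , λ j → (λ n → σ n j) , cong (λ s → s j) σ₀ , λ n → proj₂ (path n) j)
    (λ (oks , paths) → sync-path oks paths)
    where
    sync-path : (∀ n → Ok (f n)) → (∀ j → 𝐋 (T j) (inf f)) → 𝐋 (sync Ok T) (inf f)
    sync-path oks paths = σ , refl , λ n → oks n , step-at n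
      where
      σ : ℕ → State (sync Ok T)
      σ zero    j = init (T j)
      σ (suc n) j = proj₁ (paths j) (suc n)

      step-at : ∀ n j → step (T j) (σ n j) (f n) (σ (suc n) j)
      step-at zero    j =
        let _ , σⱼ₀ , pathⱼ = paths j in subst (λ q → step (T j) q (f 0) _) σⱼ₀ (pathⱼ 0)
      step-at (suc n) j = proj₂ (proj₂ (paths j)) (suc n)

module _ {Part Msg : Set} (_≟_ : DecidableEquality Part) where

  open import Data.List.Membership.DecPropositional _≟_ using (_∈?_)

  projI-sender : ∀ A B (m : Msg) .(d : A ≢ B) → projI _≟_ A (A ⟶ B ∶ m ⟨ d ⟩) ≡ just (send A B m d)
  projI-sender A B m d with A ≟ A
  ... | yes _   = refl
  ... | no A≢A = contradiction refl A≢A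

  projI-receiver : ∀ A B (m : Msg) .(d : A ≢ B) → projI _≟_ B (A ⟶ B ∶ m ⟨ d ⟩) ≡ just (recv A B m d)
  projI-receiver A B m d with B ≟ A | B ≟ B
  ... | yes B≡A | _       = ⊥-elim-irr (d (sym B≡A))
  ... | no _    | yes _   = refl
  ... | no _    | no B≢B = contradiction refl B≢B

  projI-other : ∀ {X} A B (m : Msg) .(d : A ≢ B) → X ≢ A → X ≢ B →
    projI _≟_ X (A ⟶ B ∶ m ⟨ d ⟩) ≡ nothing
  projI-other {X} A B m d X≢A X≢B with X ≟ A | X ≟ B
  ... | yes X≡A | _       = contradiction X≡A X≢A
  ... | no _    | yes X≡B = contradiction X≡B X≢B
  ... | no _    | no _    = refl

  projI-outside : ∀ {P X} {a : Int {Part} {Msg}} → ¬ X ∈ P → IntIn P a → projI _≟_ X a ≡ nothing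
  projI-outside {a = A ⟶ B ∶ m ⟨ d ⟩} X∉P (A∈P , B∈P) =
    projI-other A B m d (λ { refl → X∉P A∈P }) (λ { refl → X∉P B∈P })

  localView : (Part → FSA (Act {Part} {Msg})) → Part → LTS (Int {Part} {Msg})
  localView M X = inverseImage (projI _≟_ X) (toLTS (M X))

  module _ {P : List Part} {M : Part → FSA (Act {Part} {Msg})} where

    cs⇒sync-step : ∀ {s a s′} → step (cs P M) s a s′ → step (sync (IntIn P) (localView M)) s a s′
    cs⇒sync-step {s} {A ⟶ B ∶ m ⟨ d ⟩} {s′} (A∈P , B∈P , sends , receives , others) =
      (A∈P , B∈P) , moves
      where
      moves : ∀ X → StepMaybe (toLTS (M X)) (s X) (projI _≟_ X (A ⟶ B ∶ m ⟨ d ⟩)) (s′ X)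
      moves X with X ≟ A | X ≟ B
      ... | yes refl | _        = sends
      ... | no _     | yes refl = receives
      ... | no X≢A   | no X≢B   = others X X≢A X≢B

    sync⇒cs-step : ∀ {s a s′} → step (sync (IntIn P) (localView M)) s a s′ → step (cs P M) s a s′
    sync⇒cs-step {a = A ⟶ B ∶ m ⟨ d ⟩} ((A∈P , B∈P) , moves) =
        A∈P , B∈P
      , stepMaybe-just (projI-sender A B m d) (moves A)
      , stepMaybe-just (projI-receiver A B m d) (moves B)
      , λ X X≢A X≢B → stepMaybe-nothing (projI-other A B m d X≢A X≢B) (moves X)

    𝐋-cs : ∀ w → 𝐋 (cs P M) w ⇔ (Every (IntIn P) w × ∀ X → 𝐋 (localView M X) w)
    𝐋-cs w = 𝐋-sync w ⇔-∘
      mk⇔ (𝐋-simulation id refl cs⇒sync-step w) (𝐋-simulation id refl sync⇒cs-step w)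

  WordIn⇔Every : ∀ {P} w → WordIn {Part} {Msg} P w ⇔ Every (IntIn P) w
  WordIn⇔Every (fin l) = mk⇔ id id
  WordIn⇔Every (inf f) = mk⇔ id id

  Proj⇔IsImage : ∀ X w u → Proj {Part} {Msg} _≟_ X w u ⇔ IsImage (projI _≟_ X) w u
  Proj⇔IsImage X (fin l) u       = mk⇔ id id
  Proj⇔IsImage X (inf w) (fin l) = mk⇔ id id
  Proj⇔IsImage X (inf w) (inf v) = mk⇔ id id

  localViews⇔⟦⟧ : ExcludedMiddle 0ℓ → ∀ P (M : Part → FSA (Act {Part} {Msg})) w →
    (Every (IntIn P) w × ∀ X → 𝐋 (localView M X) w) ⇔ ⟦_∣_⟧ _≟_ P (λ X → 𝐋 (toLTS (M X))) w
  localViews⇔⟦⟧ em P M w = mk⇔ to from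
    where
    to : Every (IntIn P) w × (∀ X → 𝐋 (localView M X) w) → ⟦_∣_⟧ _≟_ P (λ X → 𝐋 (toLTS (M X))) w
    to (every , views) = Equivalence.from (WordIn⇔Every w) every , λ X _ →
      let u , image , lang = 𝐋-inverseImage⇒image (projI _≟_ X) em w (views X)
      in u , Equivalence.from (Proj⇔IsImage X w u) image , lang

    from : ⟦_∣_⟧ _≟_ P (λ X → 𝐋 (toLTS (M X))) w → Every (IntIn P) w × (∀ X → 𝐋 (localView M X) w)
    from (wordIn , langs) = every , view
      where
      every : Every (IntIn P) w
      every = Equivalence.to (WordIn⇔Every w) wordIn

      view : ∀ X → 𝐋 (localView M X) w
      view X with X ∈? P
      ... | yes X∈P = let u , proj , lang = langs X X∈P
                      in image⇒𝐋-inverseImage (projI _≟_ X) w u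
                           (Equivalence.to (Proj⇔IsImage X w u) proj) lang
      ... | no  X∉P = 𝐋-inverseImage-silent (projI _≟_ X) (projI-outside X∉P) w every

proposition6p5 : {Part Msg : Set} (_≟_ : DecidableEquality Part) → ExcludedMiddle 0ℓ →
    (P : List Part) (M : Part → FSA (Act {Part} {Msg})) → IsSystem P M →
    𝐋 (cs P M) ≐ ⟦_∣_⟧ _≟_ P (λ X → 𝐋 (toLTS (M X)))
proposition6p5 _≟_ em P M _ w = Equivalence.to languages-agree , Equivalence.from languages-agree
  where
  languages-agree : 𝐋 (cs P M) w ⇔ ⟦_∣_⟧ _≟_ P (λ X → 𝐋 (toLTS (M X))) w
  languages-agree = localViews⇔⟦⟧ _≟_ em P M w ⇔-∘ 𝐋-cs _≟_ w
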